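{- Let $b\ge 2$ be an integer and let $n,k$ be nonnegative integers with $b^k\leq n\leq b^{k+1}$. (i) If $n=jb^k$ for some $j\in\{1,\ldots,b-1\}$, then $s_b(n)=1$. (ii) If $k=1$, then $s_b(n)\leq 2$, with equality if and only if $n\equiv 1\pmod b$. (iii) If $k\geq 1$ and $n\not\equiv 1\pmod b$, then $s_b(n)=s_b(n')$ for some integer $n'$ with $b^{k-1}\leq n'\leq b^k$.
   Context: A base $b$ over-expansion of a positive integer $N$ is a word $d_kd_{k-1}\cdots d_0$ over $\{0,1,\ldots,b\}$ with $d_k\neq 0$ and $\sum_{i=0}^k d_ib^i=N$. For $n\ge 2$, $s_b(n)$ is the number of base $b$ over-expansions of $n-1$; $s_b(0)=0$, $s_b(1)=1$. -}

module Defs where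

open import Data.Nat using (ℕ; zero; suc; _+_; _*_)
open import Data.Nat.Properties using (_≟_)
open import Data.Fin using (Fin; toℕ)
open import Data.Vec using (Vec; []; _∷_; last)
open import Data.List using (List; [_]; concatMap; map; filter; length; allFin)
open import Data.Product using (_×_)
open import Relation.Nullary using (¬_; Dec; yes; no)
open import Relation.Nullary.Decidable using (_×-dec_; ¬?)
open import Relation.Binary.PropositionalEquality using (_≡_)

-- A word of length m over the digit alphabet {0,…,b}, stored as
-- d₀ ∷ d₁ ∷ … ∷ d_{m-1}  (entry i is the coefficient of b^i).
Word : ℕ → ℕ → Set
Word b m = Vec (Fin (suc b)) m

val : (b : ℕ) → {m : ℕ} → Word b m → ℕ
val b []      = 0
val b (d ∷ w) = toℕ d + b * val b w

IsOverExp : (b N : ℕ) → {k : ℕ} → Word b (suc k) → Set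
IsOverExp b N w = (¬ (toℕ (last w) ≡ 0)) × (val b w ≡ N)

isOverExp? : (b N : ℕ) → {k : ℕ} → (w : Word b (suc k)) → Dec (IsOverExp b N w)
isOverExp? b N w = ¬? (toℕ (last w) ≟ 0) ×-dec (val b w ≟ N)

allWords : (b m : ℕ) → List (Word b m)
allWords b zero    = [ [] ]
allWords b (suc m) = concatMap (λ d → map (d ∷_) (allWords b m)) (allFin (suc b))

countLen : (b N k : ℕ) → ℕ
countLen b N k = length (filter (isOverExp? b N) (allWords b (suc k)))

countUpTo : (b N L : ℕ) → ℕ
countUpTo b N zero    = 0
countUpTo b N (suc L) = countUpTo b N L + countLen b N L

-- s_b(0) = 0, s_b(1) = 1, s_b(n) = #over-expansions of n-1 for n ≥ 2.
-- Lengths up to N = n-1 suffice: for b ≥ 2 a word of length L with nonzero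
-- leading digit has value ≥ b^(L-1) ≥ L.
s : ℕ → ℕ → ℕ
s b zero          = 0
s b (suc zero)    = 1
s b (suc (suc m)) = countUpTo b (suc m) (suc m)

-- Write N = r + q b with r < b. The last digit d₀ of an over-expansion of N is congruent to N
-- modulo b, so d₀ = r, or d₀ = b when r = 0; removing it leaves an over-expansion of q, resp.
-- of q - 1 (the empty word, if we let it expand 0). Hence
--   s_b(r + q b + 1) = s_b(q + 1)            for 0 < r < b,
--   s_b(q b + 1)     = s_b(q + 1) + s_b(q)   for q ≥ 1,
-- and s_b(n) = 1 for 1 ≤ n ≤ b. Part (i) follows since s_b(j b^(k+1)) = s_b(j b^k), part (ii) by
-- applying the recurrences once to a two-digit number, part (iii) by dropping the last digit.
-- The definition counts expansions of bounded length; the recurrences hold length by length,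
-- and lengths above log_b N contribute nothing since a nonzero leading digit at position k
-- forces the value to be at least b^k.
module Submission where

open import Defs
open import Level using (Level)
open import Data.Empty using (⊥; ⊥-elim)
open import Data.Nat using (ℕ; zero; suc; pred; _+_; _*_; _∸_; _^_; _≤_; _<_; _≤′_; ≤′-refl; ≤′-step; NonZero; >-nonZero; >-nonZero⁻¹; z≤n; s≤s; z<s)
open import Data.Nat.Properties
open import Data.Nat.DivMod using (_%_; _/_; m%n<n; m≡m%n+[m/n]*n; [m+kn]%n≡m%n; m<n⇒m%n≡m; n%n≡0)
open import Data.Fin using (Fin; zero; suc; toℕ; fromℕ; fromℕ<; inject₁)
open import Data.Fin.Properties using (toℕ-injective; toℕ<n; toℕ≤pred[n]; toℕ-fromℕ; toℕ-fromℕ<; toℕ-inject₁)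
import Data.Fin.Properties as Fin
open import Data.Vec using ([]; _∷_; last)
open import Data.List using (List; []; _∷_; [_]; _++_; map; concatMap; length; filter; tabulate)
open import Data.List.Properties using (length-++; filter-++; filter-≐; filter-none; filter-accept; filter-reject)
open import Data.List.Relation.Unary.All using (universal)
open import Data.Product using (_×_; _,_; proj₁; ∃-syntax)
open import Data.Sum using (_⊎_; inj₁; inj₂)
open import Function using (_∘_; id)
open import Function.Bundles using (_⇔_; mk⇔)
open import Relation.Nullary using (¬_; yes; no)
open import Relation.Unary using (Pred; Decidable; _≐_)
open import Relation.Binary.PropositionalEquality using (_≡_; _≢_; refl; sym; trans; cong; cong₂; subst; module ≡-Reasoning)
open import Algebra.Properties.Monoid.Sum +-0-monoid using (sum; sum-syntax; sum-cong-≗; sum-replicate-zero; sum-init-last)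
open import Algebra.Properties.CommutativeSemigroup +-commutativeSemigroup using (interchange)

private variable
  ℓ : Level
  A B : Set

module _ {P : Pred A ℓ} (P? : Decidable P) where

  count : List A → ℕ
  count = length ∘ filter P?

  count-++ : ∀ xs ys → count (xs ++ ys) ≡ count xs + count ys
  count-++ xs ys = trans (cong length (filter-++ P? xs ys)) (length-++ (filter P? xs))

  count-map : (f : B → A) → ∀ xs → count (map f xs) ≡ length (filter (P? ∘ f) xs)
  count-map f [] = refl
  count-map f (x ∷ xs) with P? (f x)
  ... | yes _ = cong suc (count-map f xs)
  ... | no _ = count-map f xs

  count-concatMap-tabulate : ∀ {n} (f : B → List A) (g : Fin n → B) →
    count (concatMap f (tabulate g)) ≡ ∑[ i < n ] count (f (g i))
  count-concatMap-tabulate {n = zero} f g = refl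
  count-concatMap-tabulate {n = suc n} f g =
    trans (count-++ (f (g zero)) _) (cong (count (f (g zero)) +_) (count-concatMap-tabulate f (g ∘ suc)))

  count-none : (∀ x → ¬ P x) → ∀ xs → count xs ≡ 0
  count-none ¬P xs = cong length (filter-none P? (universal ¬P xs))

  count-singleton-accept : ∀ x → P x → count [ x ] ≡ 1
  count-singleton-accept x Px = cong length (filter-accept P? {xs = []} Px)

  count-singleton-reject : ∀ x → ¬ P x → count [ x ] ≡ 0
  count-singleton-reject x ¬Px = cong length (filter-reject P? {xs = []} ¬Px)

count-≐ : {P Q : Pred A ℓ} (P? : Decidable P) (Q? : Decidable Q) → P ≐ Q → ∀ xs → count P? xs ≡ count Q? xs
count-≐ P? Q? P≐Q xs = cong length (filter-≐ P? Q? P≐Q xs)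

∑-zero : ∀ {n} (f : Fin n → ℕ) → (∀ i → f i ≡ 0) → ∑[ i < n ] f i ≡ 0
∑-zero {n} f f≡0 = trans (sum-cong-≗ f≡0) (sum-replicate-zero n)

∑-single : ∀ {n} (f : Fin n → ℕ) i → (∀ j → j ≢ i → f j ≡ 0) → ∑[ j < n ] f j ≡ f i
∑-single f zero others = trans (cong (f zero +_) (∑-zero (f ∘ suc) (λ j → others (suc j) λ ()))) (+-identityʳ _)
∑-single f (suc i) others =
  trans (cong (_+ sum (f ∘ suc)) (others zero λ ()))
        (∑-single (f ∘ suc) i (λ j j≢i → others (suc j) (j≢i ∘ Fin.suc-injective)))

leading-digit-bound : ∀ {b k} (w : Word b (suc k)) → toℕ (last w) ≢ 0 → b ^ k ≤ val b w
leading-digit-bound {k = zero} (d ∷ []) d≢0 = ≤-trans (n≢0⇒n>0 d≢0) (m≤m+n _ _)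
leading-digit-bound {b} {suc k} (d ∷ w) d≢0 = ≤-trans (*-monoʳ-≤ b (leading-digit-bound w d≢0)) (m≤n+m _ _)

emptyWordCount : ℕ → ℕ
emptyWordCount zero = 1
emptyWordCount (suc _) = 0

emptyWordCount-pos : ∀ {N} → 0 < N → emptyWordCount N ≡ 0
emptyWordCount-pos (s≤s _) = refl

module Recurrences (b : ℕ) .{{_ : NonZero b}} where

  0<b : 0 < b
  0<b = >-nonZero⁻¹ b

  euclid-unique : ∀ {x v r q} → x < b → r < b → x + v * b ≡ r + q * b → x ≡ r × v ≡ q
  euclid-unique {x} {v} {r} {q} x<b r<b eq = x≡r , *-cancelʳ-≡ v q b (+-cancelˡ-≡ x _ _ (trans eq (cong (_+ q * b) (sym x≡r))))
    where
    open ≡-Reasoning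
    x≡r : x ≡ r
    x≡r = begin
      x                ≡⟨ sym (m<n⇒m%n≡m x<b) ⟩
      x % b            ≡⟨ sym ([m+kn]%n≡m%n x v b) ⟩
      (x + v * b) % b  ≡⟨ cong (_% b) eq ⟩
      (r + q * b) % b  ≡⟨ [m+kn]%n≡m%n r q b ⟩
      r % b            ≡⟨ m<n⇒m%n≡m r<b ⟩
      r                ∎

  euclid : ∀ N → ∃[ r ] ∃[ q ] r < b × N ≡ r + q * b
  euclid N = N % b , N / b , m%n<n N b , m≡m%n+[m/n]*n N b

  countLen-vanishes : ∀ {N} i → N < b ^ i → countLen b N i ≡ 0
  countLen-vanishes {N} i N<b^i = count-none (isOverExp? b N)
    (λ w (d≢0 , w≡N) → <⇒≱ N<b^i (subst (b ^ i ≤_) w≡N (leading-digit-bound w d≢0)))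
    (allWords b (suc i))

  single-digit-val : ∀ d → val b (d ∷ []) ≡ toℕ d
  single-digit-val d = trans (cong (toℕ d +_) (*-zeroʳ b)) (+-identityʳ _)

  countLen-one-digit : ∀ {N} → 0 < N → N ≤ b → countLen b N 0 ≡ 1
  countLen-one-digit {N} 0<N N≤b = begin
    countLen b N 0          ≡⟨ count-concatMap-tabulate (isOverExp? b N {0}) (λ d → map (d ∷_) (allWords b 0)) id ⟩
    ∑[ d < suc b ] single d ≡⟨ ∑-single single N′ others ⟩
    single N′               ≡⟨ count-singleton-accept (isOverExp? b N) (N′ ∷ []) fits ⟩
    1                       ∎
    where
    open ≡-Reasoning
    single : Fin (suc b) → ℕ
    single d = count (isOverExp? b N {0}) [ d ∷ [] ]
    N′ : Fin (suc b)
    N′ = fromℕ< (s≤s N≤b)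
    toℕ-N′ : toℕ N′ ≡ N
    toℕ-N′ = toℕ-fromℕ< (s≤s N≤b)
    fits : IsOverExp b N (N′ ∷ [])
    fits = (λ N′≡0 → <⇒≢ 0<N (trans (sym N′≡0) toℕ-N′)) , trans (single-digit-val N′) toℕ-N′
    others : ∀ d → d ≢ N′ → single d ≡ 0
    others d d≢N′ = count-singleton-reject (isOverExp? b N) (d ∷ [])
      (λ (_ , d≡N) → d≢N′ (toℕ-injective (trans (trans (sym (single-digit-val d)) d≡N) (sym toℕ-N′))))

  countLen-one-digit-large : ∀ {N} → b < N → countLen b N 0 ≡ 0
  countLen-one-digit-large {N} b<N = count-none (isOverExp? b N)
    (λ { (d ∷ []) (_ , d≡N) → <⇒≱ b<N (subst (_≤ b) (trans (sym (single-digit-val d)) d≡N) (toℕ≤pred[n] d)) })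
    (allWords b 1)

  -- over-expansions of N of length i + 2 with d₀ = d (the head of a word is its units digit)
  withLastDigit : ℕ → ℕ → Fin (suc b) → ℕ
  withLastDigit i N d = count (isOverExp? b N ∘ (d ∷_)) (allWords b (suc i))

  countLen-suc : ∀ N i →
    countLen b N (suc i) ≡ ∑[ d < b ] withLastDigit i N (inject₁ d) + withLastDigit i N (fromℕ b)
  countLen-suc N i = begin
    countLen b N (suc i)                ≡⟨ count-concatMap-tabulate (isOverExp? b N) (λ d → map (d ∷_) words) id ⟩
    ∑[ d < suc b ] count (isOverExp? b N) (map (d ∷_) words)
      ≡⟨ sum-cong-≗ (λ d → count-map (isOverExp? b N) (d ∷_) words) ⟩
    ∑[ d < suc b ] withLastDigit i N d  ≡⟨ sum-init-last (withLastDigit i N) ⟩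
    ∑[ d < b ] withLastDigit i N (inject₁ d) + withLastDigit i N (fromℕ b)  ∎
    where
    open ≡-Reasoning
    words = allWords b (suc i)

  withLastDigit-fit : ∀ {N q} i d → N ≡ toℕ d + q * b → withLastDigit i N d ≡ countLen b q i
  withLastDigit-fit {N} {q} i d N≡ = count-≐ (isOverExp? b N ∘ (d ∷_)) (isOverExp? b q {i}) (to , from) (allWords b (suc i))
    where
    to : ∀ {w : Word b (suc i)} → IsOverExp b N (d ∷ w) → IsOverExp b q w
    to {w} (d≢0 , dw≡N) = d≢0 , *-cancelʳ-≡ (val b w) q b
      (+-cancelˡ-≡ (toℕ d) _ _ (trans (cong (toℕ d +_) (*-comm (val b w) b)) (trans dw≡N N≡)))
    from : ∀ {w : Word b (suc i)} → IsOverExp b q w → IsOverExp b N (d ∷ w)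
    from {w} (d≢0 , w≡q) = d≢0 , trans (cong (toℕ d +_) (trans (cong (b *_) w≡q) (*-comm b q))) (sym N≡)

  withLastDigit-misfit : ∀ {N} i d → (∀ v → N ≢ toℕ d + v * b) → withLastDigit i N d ≡ 0
  withLastDigit-misfit {N} i d misfit = count-none (isOverExp? b N ∘ (d ∷_))
    (λ w (_ , dw≡N) → misfit (val b w) (trans (sym dw≡N) (cong (toℕ d +_) (*-comm b (val b w)))))
    (allWords b (suc i))

  ∑-withLastDigit-low : ∀ {r q} i → r < b → ∑[ d < b ] withLastDigit i (r + q * b) (inject₁ d) ≡ countLen b q i
  ∑-withLastDigit-low {r} {q} i r<b = trans (∑-single _ r′ others) (withLastDigit-fit i (inject₁ r′) (cong (_+ q * b) (sym toℕ-r′)))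
    where
    r′ : Fin b
    r′ = fromℕ< r<b
    toℕ-r′ : toℕ (inject₁ r′) ≡ r
    toℕ-r′ = trans (toℕ-inject₁ r′) (toℕ-fromℕ< r<b)
    others : ∀ d → d ≢ r′ → withLastDigit i (r + q * b) (inject₁ d) ≡ 0
    others d d≢r′ = withLastDigit-misfit i (inject₁ d) λ v eq → d≢r′ (toℕ-injective (begin
      toℕ d             ≡⟨ sym (toℕ-inject₁ d) ⟩
      toℕ (inject₁ d)   ≡⟨ proj₁ (euclid-unique {v = v} {q = q} (subst (_< b) (sym (toℕ-inject₁ d)) (toℕ<n d)) r<b (sym eq)) ⟩
      r                 ≡⟨ sym (toℕ-fromℕ< r<b) ⟩
      toℕ r′            ∎))
      where open ≡-Reasoning

  countLen-digit : ∀ {r q} i → r < b → r ≢ 0 ⊎ q ≡ 0 → countLen b (r + q * b) (suc i) ≡ countLen b q i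
  countLen-digit {r} {q} i r<b r≢0⊎q≡0 =
    trans (countLen-suc N i) (trans (cong₂ _+_ (∑-withLastDigit-low i r<b) lastDigit≢b) (+-identityʳ _))
    where
    N = r + q * b
    lastDigit≢b : withLastDigit i N (fromℕ b) ≡ 0
    lastDigit≢b = withLastDigit-misfit i (fromℕ b) λ v eq →
      excluded r≢0⊎q≡0 (euclid-unique {q = suc v} r<b 0<b (trans eq (cong (_+ v * b) (toℕ-fromℕ b))))
      where
      excluded : ∀ {v} → r ≢ 0 ⊎ q ≡ 0 → r ≡ 0 × q ≡ suc v → ⊥
      excluded (inj₁ r≢0) (r≡0 , _)   = r≢0 r≡0
      excluded (inj₂ q≡0) (_ , q≡1+v) = 0≢1+n (trans (sym q≡0) q≡1+v)

  countLen-zero-digit : ∀ q i → countLen b (suc q * b) (suc i) ≡ countLen b (suc q) i + countLen b q i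
  countLen-zero-digit q i =
    trans (countLen-suc N i) (cong₂ _+_ (∑-withLastDigit-low i 0<b) lastDigit≡b)
    where
    N = suc q * b
    lastDigit≡b : withLastDigit i N (fromℕ b) ≡ countLen b q i
    lastDigit≡b = withLastDigit-fit i (fromℕ b) (cong (_+ q * b) (sym (toℕ-fromℕ b)))

  countUpTo-stable : ∀ {N L M} → N < b ^ L → L ≤′ M → countUpTo b N M ≡ countUpTo b N L
  countUpTo-stable N<b^L ≤′-refl = refl
  countUpTo-stable {N} {L} {suc M} N<b^L (≤′-step L≤′M) = begin
    countUpTo b N M + countLen b N M  ≡⟨ cong₂ _+_ (countUpTo-stable N<b^L L≤′M) (countLen-vanishes M N<b^M) ⟩
    countUpTo b N L + 0               ≡⟨ +-identityʳ _ ⟩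
    countUpTo b N L                   ∎
    where
    open ≡-Reasoning
    N<b^M = <-≤-trans N<b^L (^-monoʳ-≤ b (≤′⇒≤ L≤′M))

  -- over-expansions of length at most L, with the empty word counted as an expansion of 0
  countUpTo₀ : ℕ → ℕ → ℕ
  countUpTo₀ L N = emptyWordCount N + countUpTo b N L

  countUpTo₀-suc : ∀ L N → countUpTo₀ (suc L) N ≡ countUpTo₀ L N + countLen b N L
  countUpTo₀-suc L N = sym (+-assoc (emptyWordCount N) _ _)

  countUpTo₀-one-digit : ∀ {r q} → r < b → r ≢ 0 ⊎ q ≡ 0 → countUpTo₀ 1 (r + q * b) ≡ countUpTo₀ 0 q
  countUpTo₀-one-digit {zero} {zero} r<b _ = cong (1 +_) (countLen-vanishes 0 z<s)
  countUpTo₀-one-digit {suc r} {zero} r<b _ = countLen-one-digit z<s (subst (_≤ b) (cong suc (sym (+-identityʳ r))) (<⇒≤ r<b))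
  countUpTo₀-one-digit {zero} {suc q} r<b (inj₁ 0≢0) = ⊥-elim (0≢0 refl)
  countUpTo₀-one-digit {suc r} {suc q} r<b _ = countLen-one-digit-large (s≤s (≤-trans (m≤m+n b (q * b)) (m≤n+m _ r)))

  countUpTo₀-digit : ∀ {r q} → r < b → r ≢ 0 ⊎ q ≡ 0 → ∀ L → countUpTo₀ (suc L) (r + q * b) ≡ countUpTo₀ L q
  countUpTo₀-digit r<b r≢0⊎q≡0 zero = countUpTo₀-one-digit r<b r≢0⊎q≡0
  countUpTo₀-digit {r} {q} r<b r≢0⊎q≡0 (suc L) = begin
    countUpTo₀ (suc (suc L)) N                    ≡⟨ countUpTo₀-suc (suc L) N ⟩
    countUpTo₀ (suc L) N + countLen b N (suc L)   ≡⟨ cong₂ _+_ (countUpTo₀-digit r<b r≢0⊎q≡0 L) (countLen-digit L r<b r≢0⊎q≡0) ⟩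
    countUpTo₀ L q + countLen b q L               ≡⟨ countUpTo₀-suc L q ⟨
    countUpTo₀ (suc L) q                          ∎
    where
    open ≡-Reasoning
    N = r + q * b

  countUpTo₀-zero-digit : ∀ q L → countUpTo₀ (suc L) (suc q * b) ≡ countUpTo₀ L (suc q) + countUpTo₀ L q
  countUpTo₀-zero-digit q zero = trans (cong (_+ countUpTo b N 1) (emptyWordCount-pos (≤-trans 0<b (m≤m+n b _)))) (oneDigit q)
    where
    N = suc q * b
    oneDigit : ∀ q → countLen b (suc q * b) 0 ≡ countUpTo₀ 0 q
    oneDigit zero = countLen-one-digit (≤-trans 0<b (m≤m+n b 0)) (≤-reflexive (+-identityʳ b))
    oneDigit (suc q) = countLen-one-digit-large (m<m+n b (≤-trans 0<b (m≤m+n b _)))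
  countUpTo₀-zero-digit q (suc L) = begin
    countUpTo₀ (suc (suc L)) N                   ≡⟨ countUpTo₀-suc (suc L) N ⟩
    countUpTo₀ (suc L) N + countLen b N (suc L)  ≡⟨ cong₂ _+_ (countUpTo₀-zero-digit q L) (countLen-zero-digit q L) ⟩
    (C (suc q) + C q) + (Z (suc q) + Z q)        ≡⟨ interchange (C (suc q)) (C q) (Z (suc q)) (Z q) ⟩
    (C (suc q) + Z (suc q)) + (C q + Z q)        ≡⟨ cong₂ _+_ (countUpTo₀-suc L (suc q)) (countUpTo₀-suc L q) ⟨
    countUpTo₀ (suc L) (suc q) + countUpTo₀ (suc L) q  ∎
    where
    open ≡-Reasoning
    N = suc q * b
    C Z : ℕ → ℕ
    C = countUpTo₀ L
    Z m = countLen b m L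

two-iff-else-one : ∀ {m} {P : Set} → (m ≡ 2 × P) ⊎ (m ≡ 1 × ¬ P) → m ≤ 2 × (m ≡ 2 ⇔ P)
two-iff-else-one (inj₁ (m≡2 , p)) = ≤-reflexive m≡2 , mk⇔ (λ _ → p) (λ _ → m≡2)
two-iff-else-one (inj₂ (m≡1 , ¬p)) =
  ≤-trans (≤-reflexive m≡1) (s≤s z≤n) , mk⇔ (λ m≡2 → ⊥-elim (0≢1+n (suc-injective (trans (sym m≡1) m≡2)))) (⊥-elim ∘ ¬p)

module SternLike (b : ℕ) (1<b : 1 < b) where

  private instance
    b-nonZero : NonZero b
    b-nonZero = >-nonZero (<-trans z<s 1<b)

  open Recurrences b

  n<b^n : ∀ n → n < b ^ n
  n<b^n zero = z<s
  n<b^n (suc n) = begin-strict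
    suc n          ≤⟨ n<b^n n ⟩
    b ^ n          <⟨ m<m+n (b ^ n) (m^n>0 b n) ⟩
    b ^ n + b ^ n  ≡⟨ cong (b ^ n +_) (+-identityʳ (b ^ n)) ⟨
    2 * b ^ n      ≤⟨ *-monoˡ-≤ (b ^ n) 1<b ⟩
    b ^ suc n      ∎
    where open ≤-Reasoning

  digit-bound : ∀ {r q} L → r < b → q < b ^ L → r + q * b < b ^ suc L
  digit-bound {r} {q} L r<b q<b^L = begin-strict
    r + q * b  <⟨ +-monoˡ-< (q * b) r<b ⟩
    b + q * b  ≤⟨ *-monoˡ-≤ b q<b^L ⟩
    b ^ L * b  ≡⟨ *-comm (b ^ L) b ⟩
    b ^ suc L  ∎
    where open ≤-Reasoning

  s≡countUpTo₀ : ∀ {N} L → N < b ^ L → s b (suc N) ≡ countUpTo₀ L N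
  s≡countUpTo₀ {zero} L _ = cong suc (sym (countUpTo-stable {0} {0} {L} z<s z≤′n))
  s≡countUpTo₀ {suc m} L N<b^L with ≤-total (suc m) L
  ... | inj₁ m<L = sym (countUpTo-stable (n<b^n (suc m)) (≤⇒≤′ m<L))
  ... | inj₂ L≤m = countUpTo-stable N<b^L (≤⇒≤′ L≤m)

  s-digit : ∀ {r} q → r < b → r ≢ 0 ⊎ q ≡ 0 → s b (suc (r + q * b)) ≡ s b (suc q)
  s-digit {r} q r<b r≢0⊎q≡0 = begin
    s b (suc (r + q * b))           ≡⟨ s≡countUpTo₀ (suc q) (digit-bound q r<b (n<b^n q)) ⟩
    countUpTo₀ (suc q) (r + q * b)  ≡⟨ countUpTo₀-digit {r} {q} r<b r≢0⊎q≡0 q ⟩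
    countUpTo₀ q q                  ≡⟨ s≡countUpTo₀ q (n<b^n q) ⟨
    s b (suc q)                     ∎
    where open ≡-Reasoning

  s-zero-digit : ∀ q → s b (suc (suc q * b)) ≡ s b (suc (suc q)) + s b (suc q)
  s-zero-digit q = begin
    s b (suc (suc q * b))                                ≡⟨ s≡countUpTo₀ (suc (suc q)) (digit-bound (suc q) 0<b (n<b^n (suc q))) ⟩
    countUpTo₀ (suc (suc q)) (suc q * b)                 ≡⟨ countUpTo₀-zero-digit q (suc q) ⟩
    countUpTo₀ (suc q) (suc q) + countUpTo₀ (suc q) q
      ≡⟨ cong₂ _+_ (s≡countUpTo₀ (suc q) (n<b^n (suc q))) (s≡countUpTo₀ (suc q) (<-trans (n<1+n q) (n<b^n (suc q)))) ⟨
    s b (suc (suc q)) + s b (suc q)                      ∎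
    where open ≡-Reasoning

  s-one-digit : ∀ {n} → 0 < n → n ≤ b → s b n ≡ 1
  s-one-digit {suc r} _ n≤b = trans (cong (s b ∘ suc) (sym (+-identityʳ r))) (s-digit 0 n≤b (inj₂ refl))

  s-scale : ∀ {n} → 0 < n → s b (n * b) ≡ s b n
  s-scale {suc m} _ = begin
    s b (suc m * b)             ≡⟨ cong (λ b′ → s b (b′ + m * b)) (suc-pred b) ⟨
    s b (suc (pred b + m * b))  ≡⟨ s-digit m (≤-reflexive (suc-pred b)) (inj₁ (m<n⇒n≢0 (pred-mono-≤ 1<b))) ⟩
    s b (suc m)                 ∎
    where open ≡-Reasoning

  s-digit-power : ∀ {j} k → 0 < j → j < b → s b (j * b ^ k) ≡ 1
  s-digit-power {j} zero 0<j j<b = trans (cong (s b) (*-identityʳ j)) (s-one-digit 0<j (<⇒≤ j<b))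
  s-digit-power {j} (suc k) 0<j j<b = begin
    s b (j * (b * b ^ k))  ≡⟨ cong (s b) (trans (cong (j *_) (*-comm b (b ^ k))) (sym (*-assoc j (b ^ k) b))) ⟩
    s b (j * b ^ k * b)    ≡⟨ s-scale (*-mono-≤ 0<j (m^n>0 b k)) ⟩
    s b (j * b ^ k)        ≡⟨ s-digit-power k 0<j j<b ⟩
    1                      ∎
    where open ≡-Reasoning

  residue-one : ∀ {r} q → r < b → suc (r + q * b) % b ≡ 1 → r ≡ 0
  residue-one {r} q r<b eq = from-residue (m≤n⇒m<n∨m≡n r<b) (trans (sym ([m+kn]%n≡m%n (suc r) q b)) eq)
    where
    from-residue : suc r < b ⊎ suc r ≡ b → suc r % b ≡ 1 → r ≡ 0
    from-residue (inj₁ 1+r<b) 1+r%b≡1 = suc-injective (trans (sym (m<n⇒m%n≡m 1+r<b)) 1+r%b≡1)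
    from-residue (inj₂ 1+r≡b) 1+r%b≡1 = ⊥-elim (0≢1+n (trans (sym (n%n≡0 b)) (trans (cong (_% b) (sym 1+r≡b)) 1+r%b≡1)))

  residue-zero : ∀ q → suc (q * b) % b ≡ 1
  residue-zero q = trans ([m+kn]%n≡m%n 1 q b) (m<n⇒m%n≡m 1<b)

  quotient-upper : ∀ {r q} L → suc (r + q * b) ≤ b ^ suc L → q < b ^ L
  quotient-upper {r} {q} L n≤b^L+1 = *-cancelʳ-< b q (b ^ L) (begin-strict
    q * b            ≤⟨ m≤n+m (q * b) r ⟩
    r + q * b        <⟨ n≤b^L+1 ⟩
    b ^ suc L        ≡⟨ *-comm b (b ^ L) ⟩
    b ^ L * b        ∎)
    where open ≤-Reasoning

  quotient-lower : ∀ {r q} L → r < b → b ^ suc L ≤ suc (r + q * b) → b ^ L ≤ suc q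
  quotient-lower {r} {q} L r<b b^L+1≤n = *-cancelʳ-≤ (b ^ L) (suc q) b (begin
    b ^ L * b        ≡⟨ *-comm (b ^ L) b ⟩
    b ^ suc L        ≤⟨ b^L+1≤n ⟩
    suc (r + q * b)  ≤⟨ +-monoˡ-≤ (q * b) r<b ⟩
    suc q * b        ∎)
    where open ≤-Reasoning

  s-two-digits : ∀ {n} → b ^ 1 ≤ n → n ≤ b ^ 2 → s b n ≤ 2 × (s b n ≡ 2 ⇔ n % b ≡ 1)
  s-two-digits {zero} b≤0 _ = ⊥-elim (<⇒≱ (m^n>0 b 1) b≤0)
  s-two-digits {suc N} b≤n n≤b² with euclid N
  ... | zero , zero , _ , refl = ⊥-elim (<⇒≱ (≤-trans 1<b (≤-reflexive (sym (*-identityʳ b)))) b≤n)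
  ... | zero , suc q , _ , refl = two-iff-else-one (inj₁ (two , residue-zero (suc q)))
    where
    q+1<b = subst (suc q <_) (*-identityʳ b) (quotient-upper {0} 1 n≤b²)
    two : s b (suc (suc q * b)) ≡ 2
    two = trans (s-zero-digit q) (cong₂ _+_ (s-one-digit z<s q+1<b) (s-one-digit z<s (<⇒≤ q+1<b)))
  ... | suc r , q , r<b , refl = two-iff-else-one (inj₂ (one , λ n%b≡1 → 1+n≢0 (residue-one q r<b n%b≡1)))
    where
    one : s b (suc (suc r + q * b)) ≡ 1
    one = trans (s-digit q r<b (inj₁ 1+n≢0)) (s-one-digit z<s (subst (suc q ≤_) (*-identityʳ b) (quotient-upper 1 n≤b²)))

  s-drop-digit : ∀ {k n} → 1 ≤ k → b ^ k ≤ n → n ≤ b ^ (1 + k) → n % b ≢ 1 →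
    ∃[ n′ ] (b ^ (k ∸ 1) ≤ n′ × n′ ≤ b ^ k × s b n ≡ s b n′)
  s-drop-digit {suc k} {zero} _ b^k≤0 _ _ = ⊥-elim (<⇒≱ (m^n>0 b (suc k)) b^k≤0)
  s-drop-digit {suc k} {suc N} _ b^k≤n n≤b^k+1 n%b≢1 with euclid N
  ... | zero , q , _ , refl = ⊥-elim (n%b≢1 (residue-zero q))
  ... | suc r , q , r<b , refl =
    suc q , quotient-lower k r<b b^k≤n , quotient-upper (suc k) n≤b^k+1 , s-digit q r<b (inj₁ 1+n≢0)

lemma5 : (b n k : ℕ) → .{{_ : NonZero b}} → 2 ≤ b → b ^ k ≤ n → n ≤ b ^ (k + 1) →
    ((j : ℕ) → 1 ≤ j → j < b → n ≡ j * b ^ k → s b n ≡ 1)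
    × (k ≡ 1 → (s b n ≤ 2) × ((s b n ≡ 2) ⇔ (n % b ≡ 1)))
    × (1 ≤ k → ¬ (n % b ≡ 1) →
        ∃[ n' ] ((b ^ (k ∸ 1) ≤ n') × (n' ≤ b ^ k) × (s b n ≡ s b n')))
lemma5 b n k 2≤b b^k≤n n≤b^[k+1] = power , two-digits b^k≤n n≤b^[k+1] , drop-digit
  where
  open SternLike b 2≤b
  power : (j : ℕ) → 1 ≤ j → j < b → n ≡ j * b ^ k → s b n ≡ 1
  power j 0<j j<b n≡j*b^k = trans (cong (s b) n≡j*b^k) (s-digit-power k 0<j j<b)
  two-digits : ∀ {k} → b ^ k ≤ n → n ≤ b ^ (k + 1) → k ≡ 1 → s b n ≤ 2 × (s b n ≡ 2 ⇔ n % b ≡ 1)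
  two-digits b^1≤n n≤b^2 refl = s-two-digits b^1≤n n≤b^2
  drop-digit : 1 ≤ k → n % b ≢ 1 → ∃[ n′ ] (b ^ (k ∸ 1) ≤ n′ × n′ ≤ b ^ k × s b n ≡ s b n′)
  drop-digit 1≤k = s-drop-digit 1≤k b^k≤n (subst (λ e → n ≤ b ^ e) (+-comm k 1) n≤b^[k+1])
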